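{- For every $n$ and every positive integer $t$, there exists an $n$-vertex unweighted directed graph $G=(V,E)$ with diameter $2(t+1)$ such that any subgraph $H=(V,E')$, $E'\subseteq E$, with $\mathrm{diam}(H)\le 3t+1$ contains $\Omega(n^2/t^2)$ edges.
   Context: $d_G(u,v)$ is the number of edges of a shortest $u$-to-$v$ path and $\mathrm{diam}(G)=\max_{u,v}d_G(u,v)$. -}

module Defs where

open import Data.Nat using (ℕ; zero; suc; _+_; _*_; _≤_; _<_)
open import Data.Fin using (Fin)
open import Data.Bool using (Bool; true; false; if_then_else_)
open import Data.List using (List; map; allFin)
open import Data.Nat.ListAction using (sum)
open import Data.Product using (Σ; ∃; ∃-syntax; _×_; _,_)
open import Relation.Nullary using (¬_)
open import Relation.Binary.PropositionalEquality using (_≡_)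

Digraph : ℕ → Set
Digraph n = Fin n → Fin n → Bool

Loopless : ∀ {n} → Digraph n → Set
Loopless {n} G = ∀ (u : Fin n) → G u u ≡ false

SubgraphOf : ∀ {n} → Digraph n → Digraph n → Set
SubgraphOf {n} H G = ∀ (u v : Fin n) → H u v ≡ true → G u v ≡ true

edgeCount : ∀ {n} → Digraph n → ℕ
edgeCount {n} G =
  sum (map (λ u → sum (map (λ v → if G u v then 1 else 0) (allFin n))) (allFin n))

data Walk {n : ℕ} (G : Digraph n) : Fin n → Fin n → ℕ → Set where
  here : ∀ {u} → Walk G u u 0
  step : ∀ {u w v k} → G u w ≡ true → Walk G w v k → Walk G u v (suc k)

DistLe : ∀ {n} → Digraph n → Fin n → Fin n → ℕ → Set
DistLe G u v k = ∃[ j ] (j ≤ k × Walk G u v j)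

DiamLe : ∀ {n} → Digraph n → ℕ → Set
DiamLe {n} G D = ∀ (u v : Fin n) → DistLe G u v D

DiamEq : ∀ {n} → Digraph n → ℕ → Set
DiamEq {n} G D =
  DiamLe G D × Σ (Fin n) λ u → Σ (Fin n) λ v → ∀ j → j < D → ¬ Walk G u v j

module Submission where

-- Fix t ≥ 1 and let top = 2t+1.  The graph G has levels 0, …, top of m
-- vertices each; a vertex carries the label (level, index).  Index i of a
-- level points to index i of the next level, all m² edges are present from
-- level t to level t+1, and every vertex of level top points to every
-- vertex of a level ≤ t.  The n - (top+1)·m surplus vertices copy (0,0).
-- Climbing, wrapping around at most once and crossing from level t joins
-- any two labels in ≤ top+1 = 2(t+1) steps, while (0,0) needs top+1 steps
-- to reach (0,1): so diam G = 2(t+1).  A walk from (0,i) to (top,j) with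
-- at most 3t+1 = t+top edges is too short to wrap around, hence it climbs
-- index i up to level t and uses the crossing edge (t,i) → (t+1,j).  So a
-- subgraph of diameter ≤ 3t+1 keeps all m² crossing edges, and choosing
-- m = ⌊n/(2t+2)⌋ gives n² ≤ 64·t²·m² ≤ 64·t²·|E(H)|.

open import Defs
open import Data.Nat
  using (ℕ; zero; suc; _+_; _*_; _∸_; _≤_; _<_; _≟_; _≤?_; _<?_; z≤n; s≤s; NonZero; >-nonZero; >-nonZero⁻¹)
open import Data.Nat.Properties
open import Data.Nat.DivMod
open import Data.Nat.Divisibility using (n∣m*n)
open import Data.Nat.ListAction using (sum)
open import Data.Nat.Tactic.RingSolver using (solve-∀)
open import Data.Fin using (Fin; toℕ; fromℕ<) renaming (zero to fzero; suc to fsuc)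
open import Data.Fin.Properties using (toℕ-fromℕ<; toℕ-injective)
open import Data.Bool using (true; if_then_else_)
open import Data.List using (map; allFin; tabulate)
open import Data.List.Properties using (map-tabulate)
open import Data.Product using (Σ; _×_; _,_)
open import Data.Sum using (_⊎_; inj₁; inj₂)
open import Relation.Nullary using (¬_; Dec; yes; no; does; contradiction)
open import Relation.Nullary.Decidable using (_×-dec_; _⊎-dec_; dec-true; dec-false)
open import Relation.Binary.PropositionalEquality

decided : {A : Set} (d : Dec A) → does d ≡ true → A
decided (yes a) _ = a
decided (no _)  ()

indicator-true : ∀ {b} → b ≡ true → 1 ≤ (if b then 1 else 0)
indicator-true refl = s≤s z≤n

sum-tabulate-window : ∀ n (f : Fin n → ℕ) a m c →
  (∀ k → a ≤ toℕ k → toℕ k < a + m → c ≤ f k) → a + m ≤ n →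
  m * c ≤ sum (tabulate f)
sum-tabulate-window n       f a       zero    c _ _ = z≤n
sum-tabulate-window zero    f a       (suc m) c _ a+m≤0 =
  contradiction (≤-trans (m≤n+m (suc m) a) a+m≤0) λ ()
sum-tabulate-window (suc n) f zero    (suc m) c big (s≤s m≤n) =
  +-mono-≤ (big fzero z≤n (s≤s z≤n))
           (sum-tabulate-window n (λ k → f (fsuc k)) zero m c
              (λ k _ k<m → big (fsuc k) z≤n (s≤s k<m)) m≤n)
sum-tabulate-window (suc n) f (suc a) (suc m) c big (s≤s a+m≤n) =
  ≤-trans (sum-tabulate-window n (λ k → f (fsuc k)) a (suc m) c
             (λ k a≤k k<a+m → big (fsuc k) (s≤s a≤k) (s≤s k<a+m)) a+m≤n)
          (m≤n+m _ (f fzero))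

sum-window : ∀ n (f : Fin n → ℕ) a m c →
  (∀ k → a ≤ toℕ k → toℕ k < a + m → c ≤ f k) → a + m ≤ n →
  m * c ≤ sum (map f (allFin n))
sum-window n f a m c big a+m≤n =
  subst (m * c ≤_) (cong sum (sym (map-tabulate (λ k → k) f)))
        (sum-tabulate-window n f a m c big a+m≤n)

module Layered (t : ℕ) where

  top : ℕ
  top = t + suc t

  t<top : t < top
  t<top = m≤n+m (suc t) t

  Edge : ℕ → ℕ → ℕ → ℕ → Set
  Edge ℓ i ℓ' i' = (ℓ ≡ top × ℓ' ≤ t) ⊎ (ℓ' ≡ suc ℓ × (ℓ ≡ t ⊎ i' ≡ i))

  pattern wrap p q = inj₁ (p , q)
  pattern rise q r = inj₂ (q , r)

  edge? : ∀ ℓ i ℓ' i' → Dec (Edge ℓ i ℓ' i')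
  edge? ℓ i ℓ' i' = (ℓ ≟ top ×-dec ℓ' ≤? t) ⊎-dec (ℓ' ≟ suc ℓ ×-dec (ℓ ≟ t ⊎-dec i' ≟ i))

  no-self-edge : ∀ ℓ i → ¬ Edge ℓ i ℓ i
  no-self-edge ℓ i (wrap ℓ≡top ℓ≤t) = <-irrefl ℓ≡top (≤-<-trans ℓ≤t t<top)
  no-self-edge ℓ i (rise ℓ≡1+ℓ _)   = 1+n≢n (sym ℓ≡1+ℓ)

  -- Along a rising edge, one unit of walk length turns into one level.
  rise-length : ∀ {ℓ ℓ'} k → ℓ' ≡ suc ℓ → ℓ' + k ≡ ℓ + suc k
  rise-length {ℓ} k refl = sym (+-suc ℓ k)

  module Walks {n : ℕ} (lev idx : Fin n → ℕ) (H : Digraph n)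
               (follows : ∀ {u v} → H u v ≡ true → Edge (lev u) (idx u) (lev v) (idx v)) where

    reach-top : ∀ {u v k} → Walk H u v k → lev v ≡ top → top ≤ lev u + k
    reach-top {u} here v-top = ≤-trans (≤-reflexive (sym v-top)) (m≤m+n (lev u) 0)
    reach-top {u} (step {k = k} e rest) v-top with follows e
    ... | wrap u-top _ = ≤-trans (≤-reflexive (sym u-top)) (m≤m+n (lev u) (suc k))
    ... | rise up _    = ≤-trans (reach-top rest v-top) (≤-reflexive (rise-length k up))

    -- From above level t, a walk returns to level ≤ t only by reaching the
    -- top and wrapping: at least top + 1 - ℓ steps.
    descend : ∀ {u v k} → Walk H u v k → t < lev u → lev v ≤ t → suc top ≤ lev u + k
    descend here t<u u≤t = contradiction (<-≤-trans t<u u≤t) (<-irrefl refl)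
    descend {u} (step {k = k} e rest) t<u v≤t with follows e
    ... | wrap u-top _ =
      ≤-trans (s≤s (≤-trans (≤-reflexive (sym u-top)) (m≤m+n (lev u) k)))
              (≤-reflexive (sym (+-suc (lev u) k)))
    ... | rise up _ =
      ≤-trans (descend rest (subst (t <_) (sym up) (m<n⇒m<1+n t<u)) v≤t)
              (≤-reflexive (rise-length k up))

    -- Below level t the index only changes by crossing from level t, after
    -- which the walk must descend: changing index costs top + 1 - ℓ steps.
    change-index : ∀ {u v k} → Walk H u v k → lev u ≤ t → lev v ≤ t → idx v ≢ idx u →
                   suc top ≤ lev u + k
    change-index here _ _ idx≢ = contradiction refl idx≢
    change-index {u} (step {w = w} {k = k} e rest) u≤t v≤t idx≢ with follows e
    ... | wrap u-top _ = contradiction (subst (_≤ t) u-top u≤t) (<⇒≱ t<top)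
    ... | rise up (inj₁ u≡t) =
      ≤-trans (descend rest (subst (t <_) (sym (trans up (cong suc u≡t))) (n<1+n t)) v≤t)
              (≤-reflexive (rise-length k up))
    ... | rise up (inj₂ same) with lev w ≤? t
    ...   | yes w≤t = ≤-trans (change-index rest w≤t v≤t (λ v≡w → idx≢ (trans v≡w same)))
                              (≤-reflexive (rise-length k up))
    ...   | no  w≰t = ≤-trans (descend rest (≰⇒> w≰t) v≤t) (≤-reflexive (rise-length k up))

    -- Above level t, a walk reaching the top with at most t + top - ℓ steps
    -- is too short to wrap around, so it keeps its index.
    keeps-index : ∀ {u v k} → Walk H u v k → t < lev u → lev v ≡ top → lev u + k ≤ t + top →
                  idx u ≡ idx v
    keeps-index here _ _ _ = refl
    keeps-index {u} (step {w = w} {k = k} e rest) t<u v-top short with follows e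
    ... | wrap u-top w≤t = contradiction short (<⇒≱ too-long)
      where
      t<k : t < k
      t<k = +-cancelˡ-≤ t (suc t) k (≤-trans (reach-top rest v-top) (+-monoˡ-≤ k w≤t))
      too-long : t + top < lev u + suc k
      too-long = begin-strict
        t + top     ≡⟨ +-comm t top ⟩
        top + t     <⟨ +-monoʳ-< top (m<n⇒m<1+n t<k) ⟩
        top + suc k ≡⟨ cong (_+ suc k) (sym u-top) ⟩
        lev u + suc k ∎
        where open ≤-Reasoning
    ... | rise up (inj₁ u≡t) = contradiction (sym u≡t) (<⇒≢ t<u)
    ... | rise up (inj₂ same) =
      trans (sym same)
            (keeps-index rest (subst (t <_) (sym up) (m<n⇒m<1+n t<u)) v-top
                         (≤-trans (≤-reflexive (rise-length k up)) short))

    record Crossing (i j : ℕ) : Set where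
      constructor crossing
      field
        from to    : Fin n
        edge       : H from to ≡ true
        from-level : lev from ≡ t
        from-index : idx from ≡ i
        to-level   : lev to ≡ suc t
        to-index   : idx to ≡ j

    -- A walk from level ≤ t to the top with at most t + top - ℓ steps
    -- climbs with its index and crosses directly into the target's index.
    uses-crossing : ∀ {u v k} → Walk H u v k → lev u ≤ t → lev v ≡ top → lev u + k ≤ t + top →
                    Crossing (idx u) (idx v)
    uses-crossing here u≤t u-top _ = contradiction (subst (_≤ t) u-top u≤t) (<⇒≱ t<top)
    uses-crossing {u} {v} (step {w = w} {k = k} e rest) u≤t v-top short with follows e
    ... | wrap u-top _ = contradiction (subst (_≤ t) u-top u≤t) (<⇒≱ t<top)
    ... | rise up r with lev u ≟ t
    ...   | yes u≡t =
      crossing u w e u≡t refl w-level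
        (keeps-index rest (subst (t <_) (sym w-level) (n<1+n t)) v-top
                     (≤-trans (≤-reflexive (rise-length k up)) short))
      where
      w-level : lev w ≡ suc t
      w-level = trans up (cong suc u≡t)
    ...   | no u≢t with r
    ...     | inj₁ u≡t  = contradiction u≡t u≢t
    ...     | inj₂ same =
      crossing from to edge from-level (trans from-index same) to-level to-index
      where
      c : Crossing (idx w) (idx v)
      c = uses-crossing rest (subst (_≤ t) (sym up) (≤∧≢⇒< u≤t u≢t)) v-top
                        (≤-trans (≤-reflexive (rise-length k up)) short)
      open Crossing c

-- Layout of labels in Fin n: position i + ℓ·m carries level ℓ and index i
-- for ℓ ≤ top and i < m; the positions from (top+1)·m on carry (0 , 0).
module Blocks (top m n : ℕ) {{_ : NonZero m}} (fits : suc top * m ≤ n) where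

  position : ℕ → ℕ → ℕ
  position ℓ i = i + ℓ * m

  level : ℕ → ℕ
  level k with k <? suc top * m
  ... | yes _ = k / m
  ... | no  _ = 0

  index : ℕ → ℕ
  index k with k <? suc top * m
  ... | yes _ = k % m
  ... | no  _ = 0

  level≤top : ∀ k → level k ≤ top
  level≤top k with k <? suc top * m
  ... | yes k<M = ≤-pred (m<n*o⇒m/o<n k<M)
  ... | no  _   = z≤n

  index<m : ∀ k → index k < m
  index<m k with k <? suc top * m
  ... | yes _ = m%n<n k m
  ... | no  _ = >-nonZero⁻¹ m

  position<M : ∀ {ℓ i} → ℓ ≤ top → i < m → position ℓ i < suc top * m
  position<M {ℓ} ℓ≤top i<m = ≤-trans (+-monoˡ-≤ (ℓ * m) i<m) (*-monoˡ-≤ m (s≤s ℓ≤top))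

  level-position : ∀ {ℓ i} → ℓ ≤ top → i < m → level (position ℓ i) ≡ ℓ
  level-position {ℓ} {i} ℓ≤top i<m with position ℓ i <? suc top * m
  ... | no  outside = contradiction (position<M ℓ≤top i<m) outside
  ... | yes _ = begin
    (i + ℓ * m) / m       ≡⟨ +-distrib-/-∣ʳ i (n∣m*n ℓ) ⟩
    i / m + ℓ * m / m     ≡⟨ cong₂ _+_ (m<n⇒m/n≡0 i<m) (m*n/n≡m ℓ m) ⟩
    ℓ                     ∎
    where open ≡-Reasoning

  index-position : ∀ {ℓ i} → ℓ ≤ top → i < m → index (position ℓ i) ≡ i
  index-position {ℓ} {i} ℓ≤top i<m with position ℓ i <? suc top * m
  ... | no  outside = contradiction (position<M ℓ≤top i<m) outside
  ... | yes _ = trans ([m+kn]%n≡m%n i ℓ m) (m<n⇒m%n≡m i<m)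

  position-label : ∀ k → level k ≢ 0 → k ≡ position (level k) (index k)
  position-label k level≢0 with k <? suc top * m
  ... | yes _ = m≡m%n+[m/n]*n k m
  ... | no  _ = contradiction refl level≢0

  lev idx : Fin n → ℕ
  lev u = level (toℕ u)
  idx u = index (toℕ u)

  at : ∀ ℓ i → ℓ ≤ top → i < m → Fin n
  at ℓ i ℓ≤top i<m = fromℕ< (<-≤-trans (position<M ℓ≤top i<m) fits)

  lev-at : ∀ {ℓ i} (ℓ≤top : ℓ ≤ top) (i<m : i < m) → lev (at ℓ i ℓ≤top i<m) ≡ ℓ
  lev-at ℓ≤top i<m = trans (cong level (toℕ-fromℕ< _)) (level-position ℓ≤top i<m)

  idx-at : ∀ {ℓ i} (ℓ≤top : ℓ ≤ top) (i<m : i < m) → idx (at ℓ i ℓ≤top i<m) ≡ i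
  idx-at ℓ≤top i<m = trans (cong index (toℕ-fromℕ< _)) (index-position ℓ≤top i<m)

  label-injective : ∀ {u v} → lev u ≡ lev v → idx u ≡ idx v → lev u ≢ 0 → u ≡ v
  label-injective {u} {v} same-lev same-idx lev≢0 = toℕ-injective (begin
    toℕ u                     ≡⟨ position-label (toℕ u) lev≢0 ⟩
    position (lev u) (idx u)  ≡⟨ cong₂ position same-lev same-idx ⟩
    position (lev v) (idx v)  ≡⟨ sym (position-label (toℕ v) (λ v≡0 → lev≢0 (trans same-lev v≡0))) ⟩
    toℕ v                     ∎)
    where open ≡-Reasoning

  window-level : ∀ {ℓ} u → ℓ ≤ top → ℓ * m ≤ toℕ u → toℕ u < ℓ * m + m → lev u ≡ ℓ
  window-level {ℓ} u ℓ≤top lo hi = begin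
    lev u                                ≡⟨ cong level (sym (m∸n+n≡m lo)) ⟩
    level (position ℓ (toℕ u ∸ ℓ * m))   ≡⟨ level-position ℓ≤top offset<m ⟩
    ℓ                                    ∎
    where
    open ≡-Reasoning
    offset<m : toℕ u ∸ ℓ * m < m
    offset<m = subst (toℕ u ∸ ℓ * m <_) (m+n∸m≡n (ℓ * m) m) (∸-monoˡ-< hi lo)

  window-fits : ∀ {ℓ} → ℓ ≤ top → ℓ * m + m ≤ n
  window-fits {ℓ} ℓ≤top = ≤-trans (≤-reflexive (+-comm (ℓ * m) m)) (≤-trans (*-monoˡ-≤ m (s≤s ℓ≤top)) fits)

module Construction (t m n : ℕ) {{_ : NonZero m}} (fits : suc (Layered.top t) * m ≤ n) where
  open Layered t
  open Blocks top m n fits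

  G : Digraph n
  G u v = does (edge? (lev u) (idx u) (lev v) (idx v))

  G-follows : ∀ {u v} → G u v ≡ true → Edge (lev u) (idx u) (lev v) (idx v)
  G-follows = decided (edge? _ _ _ _)

  edge-in-G : ∀ {u v ℓ' i'} → Edge (lev u) (idx u) ℓ' i' → lev v ≡ ℓ' → idx v ≡ i' → G u v ≡ true
  edge-in-G e refl refl = dec-true (edge? _ _ _ _) e

  loopless : Loopless G
  loopless u = dec-false (edge? _ _ _ _) (no-self-edge (lev u) (idx u))

  data Route : ℕ → ℕ → ℕ → ℕ → ℕ → Set where
    stop : ∀ {ℓ i} → Route ℓ i ℓ i 0
    go   : ∀ {ℓ i ℓ₁ i₁ ℓ' i' k} → Edge ℓ i ℓ₁ i₁ → ℓ₁ ≤ top → i₁ < m →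
           Route ℓ₁ i₁ ℓ' i' k → Route ℓ i ℓ' i' (suc k)

  infixr 5 _++_
  _++_ : ∀ {ℓ i ℓ₁ i₁ ℓ' i' k k'} → Route ℓ i ℓ₁ i₁ k → Route ℓ₁ i₁ ℓ' i' k' → Route ℓ i ℓ' i' (k + k')
  stop          ++ r' = r'
  go e h₁ h₂ r  ++ r' = go e h₁ h₂ (r ++ r')

  lift : ∀ {ℓ i ℓ' i' k} → Route ℓ i ℓ' i' k → 1 ≤ k →
         ∀ {u v} → lev u ≡ ℓ → idx u ≡ i → lev v ≡ ℓ' → idx v ≡ i' → Walk G u v k
  lift (go e _ _ stop) _ refl refl v-lev v-idx = step (edge-in-G e v-lev v-idx) here
  lift (go e ℓ₁≤top i₁<m rest@(go _ _ _ _)) _ refl refl v-lev v-idx =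
    step (edge-in-G e (lev-at ℓ₁≤top i₁<m) (idx-at ℓ₁≤top i₁<m))
         (lift rest (s≤s z≤n) (lev-at ℓ₁≤top i₁<m) (idx-at ℓ₁≤top i₁<m) v-lev v-idx)

  climb-by : ∀ d {ℓ ℓ' i} → ℓ + d ≡ ℓ' → ℓ' ≤ top → i < m → Route ℓ i ℓ' i d
  climb-by zero    {ℓ} {ℓ'} {i} ℓ+0≡ℓ' _ _ =
    subst (λ x → Route ℓ i x i 0) (trans (sym (+-identityʳ ℓ)) ℓ+0≡ℓ') stop
  climb-by (suc d) {ℓ} {ℓ'} ℓ+d≡ℓ' ℓ'≤top i<m =
    go (rise refl (inj₂ refl)) (≤-trans 1+ℓ≤ℓ' ℓ'≤top) i<m
       (climb-by d (trans (sym (+-suc ℓ d)) ℓ+d≡ℓ') ℓ'≤top i<m)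
    where
    1+ℓ≤ℓ' : suc ℓ ≤ ℓ'
    1+ℓ≤ℓ' = ≤-trans (s≤s (m≤m+n ℓ d)) (≤-reflexive (trans (sym (+-suc ℓ d)) ℓ+d≡ℓ'))

  climb : ∀ {ℓ ℓ' i} → ℓ ≤ ℓ' → ℓ' ≤ top → i < m → Route ℓ i ℓ' i (ℓ' ∸ ℓ)
  climb ℓ≤ℓ' = climb-by _ (m+[n∸m]≡n ℓ≤ℓ')

  wrap-to : ∀ {i ℓ' i'} → ℓ' ≤ t → i' < m → Route top i ℓ' i' 1
  wrap-to ℓ'≤t i'<m = go (wrap refl ℓ'≤t) (≤-trans ℓ'≤t (<⇒≤ t<top)) i'<m stop

  cross-to : ∀ {i i'} → i' < m → Route t i (suc t) i' 1
  cross-to i'<m = go (rise refl (inj₁ refl)) t<top i'<m stop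

  climb-from-above : ∀ {ℓ} → t < ℓ → top ∸ ℓ ≤ t
  climb-from-above t<ℓ = ≤-trans (∸-monoʳ-≤ top t<ℓ) (≤-reflexive (m+n∸n≡m t (suc t)))

  climb-to-below : ∀ {ℓ'} → ℓ' ≤ top → ℓ' ∸ suc t ≤ t
  climb-to-below ℓ'≤top = ≤-trans (∸-monoˡ-≤ (suc t) ℓ'≤top) (≤-reflexive (m+n∸n≡m t (suc t)))

  to-level-t : ∀ {ℓ i} → ℓ ≤ top → i < m →
               Σ ℕ λ j → j < m × Σ ℕ λ k → k ≤ t + 1 × Route ℓ i t j k
  to-level-t {ℓ} {i} ℓ≤top i<m with ℓ ≤? t
  ... | yes ℓ≤t = i , i<m , t ∸ ℓ , ≤-trans (m∸n≤m t ℓ) (m≤m+n t 1) , climb ℓ≤t (<⇒≤ t<top) i<m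
  ... | no  ℓ≰t = 0 , >-nonZero⁻¹ m , (top ∸ ℓ) + 1 ,
                  +-monoˡ-≤ 1 (climb-from-above (≰⇒> ℓ≰t)) ,
                  climb ℓ≤top ≤-refl i<m ++ wrap-to ≤-refl (>-nonZero⁻¹ m)

  -- Any two labels are joined by a nonempty route of length ≤ top + 1:
  -- towards level ≤ t climb to the top and wrap; towards a level above t
  -- reach level t, cross into the target index and climb.
  route : ∀ {ℓ i ℓ' i'} → ℓ ≤ top → i < m → ℓ' ≤ top → i' < m →
          Σ ℕ λ k → 1 ≤ k × k ≤ suc top × Route ℓ i ℓ' i' k
  route {ℓ} {i} {ℓ'} {i'} ℓ≤top i<m ℓ'≤top i'<m with ℓ' ≤? t
  ... | yes ℓ'≤t =
    (top ∸ ℓ) + 1 , m≤n+m 1 _ ,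
    ≤-trans (+-monoˡ-≤ 1 (m∸n≤m top ℓ)) (≤-reflexive (+-comm top 1)) ,
    climb ℓ≤top ≤-refl i<m ++ wrap-to ℓ'≤t i'<m
  ... | no ℓ'≰t with to-level-t ℓ≤top i<m
  ...   | j , j<m , k , k≤t+1 , to-t =
    k + (1 + (ℓ' ∸ suc t)) , ≤-trans (s≤s z≤n) (m≤n+m _ k) ,
    ≤-trans (+-mono-≤ k≤t+1 (s≤s (climb-to-below ℓ'≤top))) (≤-reflexive (two-halves t)) ,
    to-t ++ cross-to i'<m ++ climb (≰⇒> ℓ'≰t) ℓ'≤top i'<m
    where
    two-halves : ∀ t → (t + 1) + (1 + t) ≡ suc (t + suc t)
    two-halves = solve-∀

  diameter-upper : DiamLe G (suc top)
  diameter-upper u v with route (level≤top (toℕ u)) (index<m (toℕ u)) (level≤top (toℕ v)) (index<m (toℕ v))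
  ... | k , 1≤k , k≤ , r = k , k≤ , lift r 1≤k refl refl refl refl

  diameter : 2 ≤ m → DiamEq G (suc top)
  diameter 2≤m = diameter-upper , origin , neighbour , too-short
    where
    open Walks lev idx G G-follows
    0<m : 0 < m
    0<m = >-nonZero⁻¹ m
    origin neighbour : Fin n
    origin    = at 0 0 z≤n 0<m
    neighbour = at 0 1 z≤n 2≤m
    level-0≤t : ∀ {i} (i<m : i < m) → lev (at 0 i z≤n i<m) ≤ t
    level-0≤t i<m = subst (_≤ t) (sym (lev-at z≤n i<m)) z≤n
    apart : ∀ {j} → Walk G origin neighbour j → suc top ≤ j
    apart {j} w = subst (λ ℓ → suc top ≤ ℓ + j) (lev-at z≤n 0<m)
      (change-index w (level-0≤t 0<m) (level-0≤t 2≤m)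
         (λ 1≡0 → 1+n≢0 (trans (sym (idx-at z≤n 2≤m)) (trans 1≡0 (idx-at z≤n 0<m)))))
    too-short : ∀ j → j < suc top → ¬ Walk G origin neighbour j
    too-short j j<top+1 w = <⇒≱ j<top+1 (apart w)

  -- A subgraph of diameter ≤ t + top keeps every edge from level t to level
  -- t+1: the short walk from (0, idx u) to (top, idx v) must cross at u → v.
  keeps-crossing-edges : 1 ≤ t → (H : Digraph n) → SubgraphOf H G → DiamLe H (t + top) →
                         ∀ u v → lev u ≡ t → lev v ≡ suc t → H u v ≡ true
  keeps-crossing-edges 1≤t H H⊆G short u v u-level v-level = subst₂ (λ x y → H x y ≡ true) from≡u to≡v edge
    where
    open Walks lev idx H (λ e → G-follows (H⊆G _ _ e))
    source target : Fin n
    source = at 0 (idx u) z≤n (index<m (toℕ u))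
    target = at top (idx v) ≤-refl (index<m (toℕ v))
    source-level : lev source ≡ 0
    source-level = lev-at z≤n (index<m (toℕ u))
    c : Crossing (idx source) (idx target)
    c with short source target
    ... | k , k≤ , w = uses-crossing w (subst (_≤ t) (sym source-level) z≤n) (lev-at ≤-refl (index<m (toℕ v)))
                                     (subst (λ ℓ → ℓ + k ≤ t + top) (sym source-level) k≤)
    open Crossing c
    from≡u : from ≡ u
    from≡u = label-injective (trans from-level (sym u-level))
                             (trans from-index (idx-at z≤n (index<m (toℕ u))))
                             (λ from≡0 → contradiction (subst (1 ≤_) (trans (sym from-level) from≡0) 1≤t) λ ())
    to≡v : to ≡ v
    to≡v = label-injective (trans to-level (sym v-level))
                           (trans to-index (idx-at ≤-refl (index<m (toℕ v))))
                           (λ to≡0 → 1+n≢0 (trans (sym to-level) to≡0))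

  -- Hence such a subgraph has at least m² edges: each of the m vertices of
  -- level t keeps its m edges into level t+1.
  spanner-density : 1 ≤ t → (H : Digraph n) → SubgraphOf H G → DiamLe H (t + top) →
                    m * m ≤ edgeCount H
  spanner-density 1≤t H H⊆G short = sum-window n out-degree (t * m) m m many-out (window-fits (<⇒≤ t<top))
    where
    out-degree : Fin n → ℕ
    out-degree u = sum (map (λ v → if H u v then 1 else 0) (allFin n))
    many-out : ∀ u → t * m ≤ toℕ u → toℕ u < t * m + m → m ≤ out-degree u
    many-out u lo hi = subst (_≤ out-degree u) (*-identityʳ m)
      (sum-window n (λ v → if H u v then 1 else 0) (suc t * m) m 1
        (λ v lo' hi' → indicator-true
          (keeps-crossing-edges 1≤t H H⊆G short u v
            (window-level u (<⇒≤ t<top) lo hi) (window-level v t<top lo' hi')))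
        (window-fits t<top))

-- Cutting n into ⌊n/b⌋ blocks of size b ≤ n leaves less than one block
-- over, so the blocks cover at least half of n.
blocks-cover-half : ∀ n b .{{_ : NonZero b}} → b ≤ n → n ≤ (n / b) * (2 * b)
blocks-cover-half n b b≤n = begin
  n                          ≡⟨ m≡m%n+[m/n]*n n b ⟩
  n % b + n / b * b          ≤⟨ +-monoˡ-≤ (n / b * b) (m%n≤n n b) ⟩
  b + n / b * b              ≤⟨ +-monoˡ-≤ (n / b * b) (m≤n*m b (n / b) {{>-nonZero (m≥n⇒m/n>0 b≤n)}}) ⟩
  n / b * b + n / b * b      ≡⟨ double (n / b) b ⟩
  n / b * (2 * b)            ∎
  where
  open ≤-Reasoning
  double : ∀ x y → x * y + x * y ≡ x * (2 * y)
  double = solve-∀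

levels-fit : ∀ {t} → 1 ≤ t → 2 * suc (Layered.top t) ≤ 8 * t
levels-fit {t} 1≤t = begin
  2 * suc (t + suc t)  ≡⟨ four-t-plus-four t ⟩
  4 * t + 4            ≤⟨ +-monoʳ-≤ (4 * t) (*-monoʳ-≤ 4 1≤t) ⟩
  4 * t + 4 * t        ≡⟨ eight-t t ⟩
  8 * t                ∎
  where
  open ≤-Reasoning
  four-t-plus-four : ∀ t → 2 * suc (t + suc t) ≡ 4 * t + 4
  four-t-plus-four = solve-∀
  eight-t : ∀ t → 4 * t + 4 * t ≡ 8 * t
  eight-t = solve-∀

-- The construction with m = ⌊n/(2t+2)⌋ ≥ 2 vertices per level, for which
-- n ≤ 8t·m and so n² ≤ 64t²·m² ≤ 64t²·|E(H)|.
sparse-spanner-lower-bound : ∀ (t n : ℕ) → 1 ≤ t → 64 * t ≤ n →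
  Σ (Digraph n) λ G → Loopless G × DiamEq G (2 * (t + 1)) ×
    (∀ (H : Digraph n) → SubgraphOf H G → DiamLe H (3 * t + 1) →
      n * n ≤ 64 * (t * t) * edgeCount H)
sparse-spanner-lower-bound t n 1≤t 64t≤n =
  G , loopless , subst (DiamEq G) (diameter-value t) (diameter 2≤m) ,
  λ H H⊆G short → begin
    n * n                          ≤⟨ *-mono-≤ n≤8tm n≤8tm ⟩
    (m * (8 * t)) * (m * (8 * t))  ≡⟨ square t m ⟩
    64 * (t * t) * (m * m)         ≤⟨ *-monoʳ-≤ (64 * (t * t))
                                        (spanner-density 1≤t H H⊆G (subst (DiamLe H) (stretch t) short)) ⟩
    64 * (t * t) * edgeCount H     ∎
  where
  open ≤-Reasoning
  b m : ℕ
  b = suc (Layered.top t)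
  m = n / b
  2b≤n : 2 * b ≤ n
  2b≤n = ≤-trans (levels-fit 1≤t) (≤-trans (*-monoˡ-≤ t (m≤m+n 8 56)) 64t≤n)
  2≤m : 2 ≤ m
  2≤m = ≤-trans (≤-reflexive (sym (m*n/n≡m 2 b))) (/-monoˡ-≤ b 2b≤n)
  fits : b * m ≤ n
  fits = ≤-trans (≤-reflexive (*-comm b m)) (m/n*n≤m n b)
  n≤8tm : n ≤ m * (8 * t)
  n≤8tm = ≤-trans (blocks-cover-half n b (≤-trans (m≤m+n b _) 2b≤n)) (*-monoʳ-≤ m (levels-fit 1≤t))
  open Construction t m n {{>-nonZero (≤-trans (n≤1+n 1) 2≤m)}} fits
  diameter-value : ∀ t → suc (t + suc t) ≡ 2 * (t + 1)
  diameter-value = solve-∀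
  stretch : ∀ t → 3 * t + 1 ≡ t + (t + suc t)
  stretch = solve-∀
  square : ∀ t m → (m * (8 * t)) * (m * (8 * t)) ≡ 64 * (t * t) * (m * m)
  square = solve-∀

theorem38 : Σ ℕ λ K → 1 ≤ K ×
    (∀ (t n : ℕ) → 1 ≤ t → K * t ≤ n →
      Σ (Digraph n) λ G → Loopless G × DiamEq G (2 * (t + 1)) ×
        (∀ (H : Digraph n) → SubgraphOf H G → DiamLe H (3 * t + 1) →
          n * n ≤ K * (t * t) * edgeCount H))
theorem38 = 64 , s≤s z≤n , sparse-spanner-lower-bound
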